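{- Let $G$ be a connected, claw-free, cubic graph with $G \ne K_4$. Then (a) $Z(G) \le \alpha(G)+1$, and (b) $Z(G) \le \alpha'(G)$.
   Context: All graphs are finite and simple. A graph is cubic if every vertex has degree $3$, and claw-free if it contains no induced subgraph isomorphic to $K_{1,3}$. $\alpha(G)$ is the independence number (maximum size of a set of pairwise nonadjacent vertices) and $\alpha'(G)$ is the matching number (maximum number of pairwise disjoint edges). Zero forcing: given a set $S\subseteq V(G)$ of initially colored vertices (all others uncolored), repeatedly apply the rule: if a colored vertex has exactly one uncolored neighbor, that neighbor becomes colored. $S$ is a zero forcing set if iterating this rule eventually colors all of $V(G)$. $Z(G)$, the zero forcing number, is the minimum cardinality of a zero forcing set of $G$. -}

module Defs where

open import Data.Nat using (ℕ; _≤_)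
open import Data.Bool using (Bool; true; false)
open import Data.Fin using (Fin)
open import Data.Fin.Subset using (Subset; _∈_; ∣_∣)
open import Data.List using (List; length; filter)
open import Data.List.Relation.Unary.All using (All)
open import Data.List.Relation.Unary.AllPairs using (AllPairs)
open import Data.List using (allFin)
open import Data.Product using (Σ; _×_; ∃; _,_)
open import Relation.Nullary using (¬_)
open import Relation.Binary.PropositionalEquality using (_≡_; _≢_)
open import Data.Bool.Properties using (_≟_)

record Graph (n : ℕ) : Set where
  field
    adj     : Fin n → Fin n → Bool
    sym     : ∀ u v → adj u v ≡ adj v u
    irrefl  : ∀ v → adj v v ≡ false
open Graph public

module _ {n : ℕ} (G : Graph n) where

  Adj : Fin n → Fin n → Set
  Adj u v = adj G u v ≡ true

  degree : Fin n → ℕ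
  degree v = length (filter (λ w → adj G v w ≟ true) (allFin n))

  Cubic : Set
  Cubic = ∀ v → degree v ≡ 3

  ClawFree : Set
  ClawFree = ∀ v a b c → Adj v a → Adj v b → Adj v c →
             a ≢ b → a ≢ c → b ≢ c →
             ¬ (¬ Adj a b × ¬ Adj a c × ¬ Adj b c)

  data Walk : Fin n → Fin n → Set where
    here : ∀ {u} → Walk u u
    step : ∀ {u v w} → Adj u v → Walk v w → Walk u w

  Connected : Set
  Connected = ∀ u v → Walk u v

  Complete : Set
  Complete = ∀ u v → u ≢ v → Adj u v

  -- G is isomorphic to K4 iff it has 4 vertices and is complete
  IsK4 : Set
  IsK4 = (n ≡ 4) × Complete

  Independent : Subset n → Set
  Independent S = ∀ u v → u ∈ S → v ∈ S → ¬ Adj u v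

  IsIndependenceNumber : ℕ → Set
  IsIndependenceNumber k =
    (Σ (Subset n) λ S → Independent S × ∣ S ∣ ≡ k) ×
    (∀ S → Independent S → ∣ S ∣ ≤ k)

  Disjoint : Fin n × Fin n → Fin n × Fin n → Set
  Disjoint (a , b) (c , d) = a ≢ c × a ≢ d × b ≢ c × b ≢ d

  IsEdge : Fin n × Fin n → Set
  IsEdge (a , b) = Adj a b

  Matching : List (Fin n × Fin n) → Set
  Matching M = All IsEdge M × AllPairs Disjoint M

  IsMatchingNumber : ℕ → Set
  IsMatchingNumber m =
    (Σ (List (Fin n × Fin n)) λ M → Matching M × length M ≡ m) ×
    (∀ M → Matching M → length M ≤ m)

  -- zero forcing: the final coloured set is the least set containing S and
  -- closed under the rule "a coloured vertex u whose only uncoloured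
  -- neighbour is v forces v".
  data Colored (S : Subset n) : Fin n → Set where
    init  : ∀ {v} → v ∈ S → Colored S v
    force : ∀ {u v} → Colored S u → Adj u v →
            (∀ w → Adj u w → w ≢ v → Colored S w) → Colored S v

  ZeroForcingSet : Subset n → Set
  ZeroForcingSet S = ∀ v → Colored S v

  IsZeroForcingNumber : ℕ → Set
  IsZeroForcingNumber z =
    (Σ (Subset n) λ S → ZeroForcingSet S × ∣ S ∣ ≡ z) ×
    (∀ S → ZeroForcingSet S → z ≤ ∣ S ∣)

-- S is built greedily together with an independent set I and a matching M, keeping
-- |S| ≤ |I| + 1 and |S| ≤ |M|.  Besides the set C of vertices coloured by S, the
-- process keeps every coloured vertex adjacent to a saturated one (coloured, with all
-- neighbours coloured).  When no force is possible, a coloured vertex u with an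
-- uncoloured neighbour x has a saturated neighbour s and, as u cannot force x, a second
-- uncoloured neighbour y; claw-freeness at u makes xy an edge.  Adding x to S then
-- forces y and the third neighbours x', y' of x and y, while xy extends M and x extends
-- I.  The process starts from a diamond with middle edge m₁m₂ and tips t₁, t₂, taking
-- S = {m₁, t₁, t₂} and I = {t₁, t₂}; the tips are nonadjacent because G ≠ K₄.  A
-- diamond-free graph starts from a triangle with |S| = |I| + 2, and the missing
-- independent vertex is found among the last vertices to be coloured.
module Submission where

open import Data.Bool using (true; false)
import Data.Bool as Bool
open import Data.Empty using (⊥-elim)
open import Data.Fin using (Fin; zero; suc; _≟_)
open import Data.Fin.Properties using (any?; all?; ¬∀⟶∃¬)
open import Data.Fin.Subset using (Subset; Nonempty; ⊤; ⊥; ⁅_⁆; _∪_; _∈_; _∉_; _⊆_; _⊂_; _⊃_; ∣_∣)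
open import Data.Fin.Subset.Induction using (⊃-wellFounded; Acc; acc)
open import Data.Fin.Subset.Properties
  using ( _∈?_; ∉⊥; x∈⁅x⁆; x∈⁅y⁆⇒x≡y; x∈p∪q⁺; x∈p∪q⁻; q⊆p∪q; ∪-identityˡ
        ; ∣⊥∣≡0; ∣⊤∣≡n; ∣p∣≤n; p⊆q⇒∣p∣≤∣q∣)
open import Data.List using (List; []; _∷_; foldr; length; filter; allFin)
open import Data.List.Membership.Propositional using () renaming (_∈_ to _∈ₗ_)
open import Data.List.Membership.Propositional.Properties using (∈-filter⁺; ∈-filter⁻; ∈-allFin)
open import Data.List.Relation.Unary.All as All using (All; []; _∷_)
open import Data.List.Relation.Unary.All.Properties using (All¬⇒¬Any)
open import Data.List.Relation.Unary.AllPairs as AllPairs using (AllPairs; []; _∷_)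
open import Data.List.Relation.Unary.Any using (here; there)
open import Data.List.Relation.Unary.Unique.Propositional using (Unique)
open import Data.List.Relation.Unary.Unique.Propositional.Properties using (allFin⁺; filter⁺)
open import Data.Nat using (ℕ; zero; suc; _+_; _≤_; s≤s; z≤n)
open import Data.Nat.Properties using (≤-antisym; ≤-reflexive; +-comm; +-suc; module ≤-Reasoning)
open import Data.Product using (∃; ∃₂; _×_; _,_; proj₁; proj₂; map; map₂)
open import Data.Sum using (_⊎_; inj₁; inj₂; map₁)
import Data.Vec as Vec
open import Function using (_∘_; id; case_of_)
open import Relation.Binary.PropositionalEquality using (_≡_; _≢_; refl; cong; trans; subst; subst₂)
import Relation.Binary.PropositionalEquality as ≡
open import Relation.Nullary using (¬_; Dec; yes; no)
open import Relation.Nullary.Decidable using (decidable-stable; map′; ¬?; _×-dec_; _→-dec_)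

open import Defs

-- Subsets of Fin n

module _ {n : ℕ} where

  x∈⁅x⁆∪p : ∀ {x : Fin n} {p} → x ∈ ⁅ x ⁆ ∪ p
  x∈⁅x⁆∪p {x} = x∈p∪q⁺ (inj₁ (x∈⁅x⁆ x))

  p⊆⁅x⁆∪p : ∀ {x : Fin n} {p} → p ⊆ ⁅ x ⁆ ∪ p
  p⊆⁅x⁆∪p {x} {p} = q⊆p∪q ⁅ x ⁆ p

  p⊂⁅x⁆∪p : ∀ {x : Fin n} {p} → x ∉ p → p ⊂ ⁅ x ⁆ ∪ p
  p⊂⁅x⁆∪p {x} x∉p = p⊆⁅x⁆∪p , x , x∈⁅x⁆∪p , x∉p

  x∈⁅y⁆∪p⁻ : ∀ {x y : Fin n} {p} → x ∈ ⁅ y ⁆ ∪ p → x ≡ y ⊎ x ∈ p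
  x∈⁅y⁆∪p⁻ {y = y} {p} = map₁ (x∈⁅y⁆⇒x≡y y) ∘ x∈p∪q⁻ ⁅ y ⁆ p

  ⁅⁆∪-elim : ∀ {P : Fin n → Set} {y p} → P y → (∀ {x} → x ∈ p → P x) →
    ∀ {x} → x ∈ ⁅ y ⁆ ∪ p → P x
  ⁅⁆∪-elim Py Pp x∈ with x∈⁅y⁆∪p⁻ x∈
  ... | inj₁ refl = Py
  ... | inj₂ x∈p = Pp x∈p

  Full : Subset n → Set
  Full p = ∀ x → x ∈ p

  full? : ∀ p → Dec (Full p)
  full? p = all? (_∈? p)

∣⁅x⁆∪p∣ : ∀ {n} {x : Fin n} {p} → x ∉ p → ∣ ⁅ x ⁆ ∪ p ∣ ≡ suc ∣ p ∣
∣⁅x⁆∪p∣ {x = zero} {true Vec.∷ p} x∉p = ⊥-elim (x∉p Vec.here)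
∣⁅x⁆∪p∣ {x = zero} {false Vec.∷ p} _ = cong (suc ∘ ∣_∣) (∪-identityˡ p)
∣⁅x⁆∪p∣ {x = suc x} {true Vec.∷ p} x∉p = cong suc (∣⁅x⁆∪p∣ (x∉p ∘ Vec.there))
∣⁅x⁆∪p∣ {x = suc x} {false Vec.∷ p} x∉p = ∣⁅x⁆∪p∣ (x∉p ∘ Vec.there)

module _ {n : ℕ} where

  insertAll : List (Fin n) → Subset n → Subset n
  insertAll xs p = foldr (λ x q → ⁅ x ⁆ ∪ q) p xs

  fromList : List (Fin n) → Subset n
  fromList xs = insertAll xs ⊥

  p⊆insertAll : ∀ xs {p} → p ⊆ insertAll xs p
  p⊆insertAll [] = id
  p⊆insertAll (x ∷ xs) = p⊆⁅x⁆∪p ∘ p⊆insertAll xs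

  ∈insertAll⁺ : ∀ {x xs p} → x ∈ₗ xs → x ∈ insertAll xs p
  ∈insertAll⁺ (here refl) = x∈⁅x⁆∪p
  ∈insertAll⁺ (there x∈xs) = p⊆⁅x⁆∪p (∈insertAll⁺ x∈xs)

  insertAll-elim : ∀ {P : Fin n → Set} {xs p} → All P xs → (∀ {x} → x ∈ p → P x) →
    ∀ {x} → x ∈ insertAll xs p → P x
  insertAll-elim [] Pp = Pp
  insertAll-elim (Px ∷ Pxs) Pp = ⁅⁆∪-elim Px (insertAll-elim Pxs Pp)

  fromList-elim : ∀ {P : Fin n → Set} {xs} → All P xs → ∀ {x} → x ∈ fromList xs → P x
  fromList-elim Pxs = insertAll-elim Pxs (⊥-elim ∘ ∉⊥)

  ∈fromList⁻ : ∀ {x xs} → x ∈ fromList xs → x ∈ₗ xs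
  ∈fromList⁻ = fromList-elim (All.tabulate id)

  ∣fromList∣ : ∀ {xs} → Unique xs → ∣ fromList xs ∣ ≡ length xs
  ∣fromList∣ {[]} [] = ∣⊥∣≡0 n
  ∣fromList∣ {x ∷ xs} (x∉xs ∷ xs-unique) =
    trans (∣⁅x⁆∪p∣ (All¬⇒¬Any x∉xs ∘ ∈fromList⁻)) (cong suc (∣fromList∣ xs-unique))

AllPairs-lookup : ∀ {A : Set} {R : A → A → Set} → (∀ {x y} → R x y → R y x) →
  ∀ {xs} → AllPairs R xs → ∀ {x y} → x ∈ₗ xs → y ∈ₗ xs → x ≢ y → R x y
AllPairs-lookup sym (Rx ∷ Rxs) (here refl) (here refl) x≢y = ⊥-elim (x≢y refl)
AllPairs-lookup sym (Rx ∷ Rxs) (here refl) (there y∈) _ = All.lookup Rx y∈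
AllPairs-lookup sym (Rx ∷ Rxs) (there x∈) (here refl) _ = sym (All.lookup Rx x∈)
AllPairs-lookup sym (Rx ∷ Rxs) (there x∈) (there y∈) x≢y = AllPairs-lookup sym Rxs x∈ y∈ x≢y

iterate : ∀ {n} {A : Set} {Done : A → Set} (key : A → Subset n) →
  (∀ x → Done x ⊎ ∃ λ y → key x ⊂ key y) → A → ∃ Done
iterate {Done = Done} key advance x = go x (⊃-wellFounded (key x))
  where
  go : ∀ x → Acc _⊃_ (key x) → ∃ Done
  go x (acc rec) with advance x
  ... | inj₁ done = x , done
  ... | inj₂ (y , x⊂y) = go y (rec x⊂y)

-- Cubic claw-free graphs

module _ {n : ℕ} (G : Graph n) where

  Adj-sym : ∀ {u v} → Adj G u v → Adj G v u
  Adj-sym {u} {v} uv = trans (sym G v u) uv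

  Adj-irrefl : ∀ {u v} → Adj G u v → u ≢ v
  Adj-irrefl {u} uu refl with trans (≡.sym (irrefl G u)) uu
  ... | ()

  Adj? : ∀ u v → Dec (Adj G u v)
  Adj? u v = adj G u v Bool.≟ true

  ≁-distinct : ∀ {a b c} → Adj G a b → ¬ Adj G a c → b ≢ c
  ≁-distinct ab a≁c refl = a≁c ab

  record Neighbours (v a b c : Fin n) : Set where
    field
      adj₁ : Adj G v a
      adj₂ : Adj G v b
      adj₃ : Adj G v c
      a≢b : a ≢ b
      a≢c : a ≢ c
      b≢c : b ≢ c
      only : ∀ {w} → Adj G v w → w ≡ a ⊎ w ≡ b ⊎ w ≡ c

    all : ∀ {P : Fin n → Set} → P a → P b → P c → ∀ {w} → Adj G v w → P w
    all Pa Pb Pc vw with only vw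
    ... | inj₁ refl = Pa
    ... | inj₂ (inj₁ refl) = Pb
    ... | inj₂ (inj₂ refl) = Pc

    all-but-third : ∀ {P : Fin n → Set} → P a → P b → ∀ w → Adj G v w → w ≢ c → P w
    all-but-third {P} Pa Pb w = all {λ w → w ≢ c → P w} (λ _ → Pa) (λ _ → Pb) (λ c≢c → ⊥-elim (c≢c refl))

    none : ∀ {w} → w ≢ a → w ≢ b → w ≢ c → ¬ Adj G v w
    none w≢a w≢b w≢c vw with only vw
    ... | inj₁ w≡a = w≢a w≡a
    ... | inj₂ (inj₁ w≡b) = w≢b w≡b
    ... | inj₂ (inj₂ w≡c) = w≢c w≡c

    swap₁₂ : Neighbours v b a c
    swap₁₂ = record
      { adj₁ = adj₂ ; adj₂ = adj₁ ; adj₃ = adj₃ ; a≢b = a≢b ∘ ≡.sym ; a≢c = b≢c ; b≢c = a≢c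
      ; only = all {λ w → w ≡ b ⊎ w ≡ a ⊎ w ≡ c} (inj₂ (inj₁ refl)) (inj₁ refl) (inj₂ (inj₂ refl)) }

    swap₂₃ : Neighbours v a c b
    swap₂₃ = record
      { adj₁ = adj₁ ; adj₂ = adj₃ ; adj₃ = adj₂ ; a≢b = a≢c ; a≢c = a≢b ; b≢c = b≢c ∘ ≡.sym
      ; only = all {λ w → w ≡ a ⊎ w ≡ c ⊎ w ≡ b} (inj₁ refl) (inj₂ (inj₂ refl)) (inj₂ (inj₁ refl)) }

  open Neighbours

  neighbours-of : Cubic G → ∀ v → ∃₂ λ a b → ∃ (Neighbours v a b)
  neighbours-of cubic v = from-list (filter (Adj? v) (allFin n)) (filter⁺ (Adj? v) (allFin⁺ n))
      (proj₂ ∘ ∈-filter⁻ (Adj? v) {xs = allFin n}) (∈-filter⁺ (Adj? v) (∈-allFin _)) (cubic v)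
    where
    from-list : ∀ xs → Unique xs → (∀ {w} → w ∈ₗ xs → Adj G v w) → (∀ {w} → Adj G v w → w ∈ₗ xs) →
                length xs ≡ 3 → ∃₂ λ a b → ∃ (Neighbours v a b)
    from-list (a ∷ b ∷ c ∷ []) ((a≢b ∷ a≢c ∷ []) ∷ (b≢c ∷ []) ∷ [] ∷ []) ⊆adj adj⊆ refl =
      a , b , c , record
        { adj₁ = ⊆adj (here refl) ; adj₂ = ⊆adj (there (here refl)) ; adj₃ = ⊆adj (there (there (here refl)))
        ; a≢b = a≢b ; a≢c = a≢c ; b≢c = b≢c ; only = position ∘ adj⊆ }
      where
      position : ∀ {w} → w ∈ₗ a ∷ b ∷ c ∷ [] → w ≡ a ⊎ w ≡ b ⊎ w ≡ c
      position (here w≡a) = inj₁ w≡a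
      position (there (here w≡b)) = inj₂ (inj₁ w≡b)
      position (there (there (here w≡c))) = inj₂ (inj₂ w≡c)

  third : Cubic G → ∀ {v p q} → Adj G v p → Adj G v q → p ≢ q → ∃ (Neighbours v p q)
  third cubic {v} vp vq p≢q with neighbours-of cubic v
  ... | a , b , c , N with only N vp | only N vq
  ... | inj₁ refl | inj₁ refl = ⊥-elim (p≢q refl)
  ... | inj₁ refl | inj₂ (inj₁ refl) = c , N
  ... | inj₁ refl | inj₂ (inj₂ refl) = b , swap₂₃ N
  ... | inj₂ (inj₁ refl) | inj₁ refl = c , swap₁₂ N
  ... | inj₂ (inj₁ refl) | inj₂ (inj₁ refl) = ⊥-elim (p≢q refl)
  ... | inj₂ (inj₁ refl) | inj₂ (inj₂ refl) = a , swap₂₃ (swap₁₂ N)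
  ... | inj₂ (inj₂ refl) | inj₁ refl = b , swap₁₂ (swap₂₃ N)
  ... | inj₂ (inj₂ refl) | inj₂ (inj₁ refl) = a , swap₂₃ (swap₁₂ (swap₂₃ N))
  ... | inj₂ (inj₂ refl) | inj₂ (inj₂ refl) = ⊥-elim (p≢q refl)

  neighbours : Cubic G → ∀ {v a b c} → Adj G v a → Adj G v b → Adj G v c → a ≢ b → a ≢ c → b ≢ c →
    Neighbours v a b c
  neighbours cubic va vb vc a≢b a≢c b≢c with third cubic va vb a≢b
  ... | r , N with only N vc
  ... | inj₁ c≡a = ⊥-elim (a≢c (≡.sym c≡a))
  ... | inj₂ (inj₁ c≡b) = ⊥-elim (b≢c (≡.sym c≡b))
  ... | inj₂ (inj₂ refl) = N

  no-claw : ClawFree G → ∀ {v a b c} → Neighbours v a b c → ¬ Adj G a b → ¬ Adj G a c → ¬ ¬ Adj G b c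
  no-claw clawFree {v} {a} {b} {c} N a≁b a≁c b≁c =
    clawFree v a b c (adj₁ N) (adj₂ N) (adj₃ N) (a≢b N) (a≢c N) (b≢c N) (a≁b , a≁c , b≁c)

  clawFree⇒adj : ClawFree G → ∀ {v a b c} → Neighbours v a b c → ¬ Adj G a b → ¬ Adj G a c → Adj G b c
  clawFree⇒adj clawFree {b = b} {c} N a≁b a≁c = decidable-stable (Adj? b c) (no-claw clawFree N a≁b a≁c)

  triangle-at : Cubic G → ClawFree G → ∀ u → ∃₂ λ s x → ∃ λ y → Neighbours u s x y × Adj G x y
  triangle-at cubic clawFree u with neighbours-of cubic u
  ... | a , b , c , N with Adj? b c | Adj? a c | Adj? a b
  ... | yes bc | _ | _ = a , b , c , N , bc
  ... | no _ | yes ac | _ = b , a , c , swap₁₂ N , ac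
  ... | no _ | no _ | yes ab = c , a , b , swap₁₂ (swap₂₃ N) , ab
  ... | no b≁c | no a≁c | no a≁b = ⊥-elim (no-claw clawFree N a≁b a≁c b≁c)

  triangle-completion : Cubic G → ∀ {u s x y} → Neighbours u s x y → Adj G x y →
    ∃₂ λ x' y' → Neighbours x u y x' × Neighbours y u x y'
  triangle-completion cubic Nu xy with third cubic (Adj-sym (adj₂ Nu)) xy (Adj-irrefl (adj₃ Nu))
                                     | third cubic (Adj-sym (adj₃ Nu)) (Adj-sym xy) (Adj-irrefl (adj₂ Nu))
  ... | x' , Nx | y' , Ny = x' , y' , Nx , Ny

  Walk-closed : ∀ {P : Fin n → Set} → (∀ {u v} → P u → Adj G u v → P v) → ∀ {a b} → Walk G a b → P a → P b
  Walk-closed closed here Pa = Pa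
  Walk-closed closed (step ab w) Pa = Walk-closed closed w (closed Pa ab)

  frontier : ∀ {C a b} → Walk G a b → a ∈ C → b ∉ C → ∃₂ λ u x → u ∈ C × x ∉ C × Adj G u x
  frontier here a∈C a∉C = ⊥-elim (a∉C a∈C)
  frontier {C} (step {v = v} av w) a∈C b∉C with v ∈? C
  ... | yes v∈C = frontier w v∈C b∉C
  ... | no v∉C = _ , v , a∈C , v∉C , av

  connected-cubic⇒K4 : Connected G → Cubic G → ∀ {a b c d} →
    Adj G a b → Adj G a c → Adj G a d → Adj G b c → Adj G b d → Adj G c d → IsK4 G
  connected-cubic⇒K4 connected cubic {a} {b} {c} {d} ab ac ad bc bd cd = n≡4 , complete
    where
    K : List (Fin n)
    K = a ∷ b ∷ c ∷ d ∷ []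
    pairwise : AllPairs (Adj G) K
    pairwise = (ab ∷ ac ∷ ad ∷ []) ∷ (bc ∷ bd ∷ []) ∷ (cd ∷ []) ∷ [] ∷ []
    N : ∀ {v p q r} → Adj G v p → Adj G v q → Adj G v r → Adj G p q → Adj G p r → Adj G q r → Neighbours v p q r
    N vp vq vr pq pr qr = neighbours cubic vp vq vr (Adj-irrefl pq) (Adj-irrefl pr) (Adj-irrefl qr)
    a∈ : a ∈ₗ K
    a∈ = here refl
    b∈ : b ∈ₗ K
    b∈ = there (here refl)
    c∈ : c ∈ₗ K
    c∈ = there (there (here refl))
    d∈ : d ∈ₗ K
    d∈ = there (there (there (here refl)))
    closed : ∀ {u w} → u ∈ₗ K → Adj G u w → w ∈ₗ K
    closed (here refl) = all (N ab ac ad bc bd cd) b∈ c∈ d∈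
    closed (there (here refl)) = all (N (Adj-sym ab) bc bd ac ad cd) a∈ c∈ d∈
    closed (there (there (here refl))) = all (N (Adj-sym ac) (Adj-sym bc) cd ab ad bd) a∈ b∈ d∈
    closed (there (there (there (here refl)))) = all (N (Adj-sym ad) (Adj-sym bd) (Adj-sym cd) ab ac bc) a∈ b∈ c∈
    covers : ∀ v → v ∈ₗ K
    covers v = Walk-closed closed (connected a v) a∈
    ∣K∣≡4 : ∣ fromList K ∣ ≡ 4
    ∣K∣≡4 = ∣fromList∣ (AllPairs.map Adj-irrefl pairwise)
    n≡4 : n ≡ 4
    n≡4 = ≤-antisym
      (begin
        n              ≡⟨ ∣⊤∣≡n n ⟨
        ∣ ⊤ {n} ∣      ≤⟨ p⊆q⇒∣p∣≤∣q∣ {p = ⊤} (λ {v} _ → ∈insertAll⁺ (covers v)) ⟩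
        ∣ fromList K ∣ ≡⟨ ∣K∣≡4 ⟩
        4              ∎)
      (begin 4 ≡⟨ ∣K∣≡4 ⟨ ∣ fromList K ∣ ≤⟨ ∣p∣≤n (fromList K) ⟩ n ∎)
      where open ≤-Reasoning
    complete : Complete G
    complete u v = AllPairs-lookup Adj-sym pairwise (covers u) (covers v)

  record Diamond : Set where
    field
      {m₁ m₂ t₁ t₂} : Fin n
      m₁m₂ : Adj G m₁ m₂
      m₁t₁ : Adj G m₁ t₁
      m₁t₂ : Adj G m₁ t₂
      m₂t₁ : Adj G m₂ t₁
      m₂t₂ : Adj G m₂ t₂
      t₁≢t₂ : t₁ ≢ t₂

  diamond? : Dec Diamond
  diamond? = map′
    (λ (_ , _ , _ , _ , m₁m₂ , m₁t₁ , m₁t₂ , m₂t₁ , m₂t₂ , t₁≢t₂) → record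
      { m₁m₂ = m₁m₂ ; m₁t₁ = m₁t₁ ; m₁t₂ = m₁t₂ ; m₂t₁ = m₂t₁ ; m₂t₂ = m₂t₂ ; t₁≢t₂ = t₁≢t₂ })
    (λ D → let open Diamond D in m₁ , m₂ , t₁ , t₂ , m₁m₂ , m₁t₁ , m₁t₂ , m₂t₁ , m₂t₂ , t₁≢t₂)
    (any? λ m₁ → any? λ m₂ → any? λ t₁ → any? λ t₂ →
      Adj? m₁ m₂ ×-dec Adj? m₁ t₁ ×-dec Adj? m₁ t₂ ×-dec Adj? m₂ t₁ ×-dec Adj? m₂ t₂ ×-dec ¬? (t₁ ≟ t₂))

  -- Zero forcing

  Colored-mono : ∀ {S S'} → S ⊆ S' → ∀ {v} → Colored G S v → Colored G S' v
  Colored-mono S⊆S' (init v∈S) = init (S⊆S' v∈S)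
  Colored-mono S⊆S' (force cu uv others) =
    force (Colored-mono S⊆S' cu) uv (λ w uw w≢v → Colored-mono S⊆S' (others w uw w≢v))

  force-third : ∀ {S v a b c} → Neighbours v a b c → Colored G S v → Colored G S a → Colored G S b → Colored G S c
  force-third N cv ca cb = force cv (adj₃ N) (all-but-third N ca cb)

  Forceable : Subset n → Fin n → Fin n → Set
  Forceable C f v = f ∈ C × v ∉ C × Adj G f v × (∀ w → Adj G f w → w ≢ v → w ∈ C)

  forceable? : ∀ C → Dec (∃₂ (Forceable C))
  forceable? C = any? λ f → any? λ v →
    f ∈? C ×-dec ¬? (v ∈? C) ×-dec Adj? f v ×-dec all? (λ w → Adj? f w →-dec ¬? (w ≟ v) →-dec w ∈? C)

  forceable-third : ∀ {C v a b c} → Neighbours v a b c → v ∈ C → a ∈ C → b ∈ C → c ∉ C → Forceable C v c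
  forceable-third N v∈C a∈C b∈C c∉C = v∈C , c∉C , adj₃ N , all-but-third N a∈C b∈C

  Stuck : Subset n → Set
  Stuck C = ∀ {f v} → ¬ Forceable C f v

  Saturated : Subset n → Fin n → Set
  Saturated C v = v ∈ C × (∀ {w} → Adj G v w → w ∈ C)

  Saturated-mono : ∀ {C C'} → C ⊆ C' → ∀ {v} → Saturated C v → Saturated C' v
  Saturated-mono C⊆C' (v∈C , N⊆C) = C⊆C' v∈C , C⊆C' ∘ N⊆C

  Full⇒Saturated : ∀ {C} → Full C → ∀ {v} → Saturated C v
  Full⇒Saturated full = full _ , λ _ → full _

  saturated : ∀ {C v a b c} → Neighbours v a b c → v ∈ C → a ∈ C → b ∈ C → c ∈ C → Saturated C v
  saturated N v∈C a∈C b∈C c∈C = v∈C , all N a∈C b∈C c∈C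

  Saturated⇒≁ : ∀ {C u v} → Saturated C u → v ∉ C → ¬ Adj G u v
  Saturated⇒≁ (_ , N⊆C) v∉C uv = v∉C (N⊆C uv)

  Independent-⁅⁆∪ : ∀ {I v} → Independent G I → (∀ {u} → u ∈ I → ¬ Adj G u v) → Independent G (⁅ v ⁆ ∪ I)
  Independent-⁅⁆∪ I-independent I≁v u w u∈ w∈ with x∈⁅y⁆∪p⁻ u∈ | x∈⁅y⁆∪p⁻ w∈
  ... | inj₁ refl | inj₁ refl = λ vv → Adj-irrefl vv refl
  ... | inj₁ refl | inj₂ w∈I = I≁v w∈I ∘ Adj-sym
  ... | inj₂ u∈I | inj₁ refl = I≁v u∈I
  ... | inj₂ u∈I | inj₂ w∈I = I-independent u w u∈I w∈I

  independent-fromList : ∀ {xs} → AllPairs (λ a b → ¬ Adj G a b) xs → Independent G (fromList xs)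
  independent-fromList nonadjacent u v u∈ v∈ with u ≟ v
  ... | yes refl = λ uu → Adj-irrefl uu refl
  ... | no u≢v = AllPairs-lookup (_∘ Adj-sym) nonadjacent (∈fromList⁻ u∈) (∈fromList⁻ v∈) u≢v

  module _ {C I : Subset n} (I-saturated : ∀ {v} → v ∈ I → Saturated C v) (I-independent : Independent G I) where

    private
      I⊆C : I ⊆ C
      I⊆C = proj₁ ∘ I-saturated

    adjoin : ∀ {v} → v ∉ C → Independent G (⁅ v ⁆ ∪ I) × ∣ ⁅ v ⁆ ∪ I ∣ ≡ suc ∣ I ∣
    adjoin v∉C = Independent-⁅⁆∪ I-independent (λ u∈I → Saturated⇒≁ (I-saturated u∈I) v∉C)
               , ∣⁅x⁆∪p∣ (v∉C ∘ I⊆C)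

    adjoin₂ : ∀ {a b} → a ∉ C → b ∉ C → a ≢ b → ¬ Adj G a b →
      Independent G (⁅ b ⁆ ∪ ⁅ a ⁆ ∪ I) × ∣ ⁅ b ⁆ ∪ ⁅ a ⁆ ∪ I ∣ ≡ 2 + ∣ I ∣
    adjoin₂ {a} {b} a∉C b∉C a≢b a≁b =
        Independent-⁅⁆∪ (proj₁ (adjoin a∉C))
          (⁅⁆∪-elim {P = λ u → ¬ Adj G u b} a≁b (λ u∈I → Saturated⇒≁ (I-saturated u∈I) b∉C))
      , trans (∣⁅x⁆∪p∣ (λ b∈ → ⁅⁆∪-elim {P = λ u → u ≢ b} a≢b (λ { u∈I refl → b∉C (I⊆C u∈I) }) b∈ refl))
              (cong suc (proj₂ (adjoin a∉C)))

  record ZeroForcingCertificate : Set where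
    field
      S I : Subset n
      M : List (Fin n × Fin n)
      S-forcing : ZeroForcingSet G S
      I-independent : Independent G I
      M-matching : Matching G M
      S≤1+I : ∣ S ∣ ≤ suc ∣ I ∣
      S≤M : ∣ S ∣ ≤ length M

  certificate⇒bounds : ZeroForcingCertificate → ∀ {z a m} → IsZeroForcingNumber G z →
    IsIndependenceNumber G a → IsMatchingNumber G m → (z ≤ a + 1) × (z ≤ m)
  certificate⇒bounds certificate {z} {a} {m} (_ , z-min) (_ , a-max) (_ , m-max) =
      (begin z ≤⟨ z≤S ⟩ ∣ S ∣ ≤⟨ S≤1+I ⟩ suc ∣ I ∣ ≤⟨ s≤s (a-max I I-independent) ⟩ suc a ≡⟨ +-comm 1 a ⟩ a + 1 ∎)
    , (begin z ≤⟨ z≤S ⟩ ∣ S ∣ ≤⟨ S≤M ⟩ length M ≤⟨ m-max M M-matching ⟩ m ∎)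
    where
    open ZeroForcingCertificate certificate
    open ≤-Reasoning
    z≤S : z ≤ ∣ S ∣
    z≤S = z-min S S-forcing

  module Triangle {u s x y x' y'} (Nu : Neighbours u s x y) (Nx : Neighbours x u y x') (Ny : Neighbours y u x y') where

    colored : ∀ {S} → Colored G S u → Colored G S s → Colored G S x → All (Colored G S) (y ∷ x' ∷ y' ∷ [])
    colored {S} cu cs cx = cy ∷ force-third Nx cx cu cy ∷ force-third Ny cy cu cx ∷ []
      where
      cy : Colored G S y
      cy = force-third Nu cu cs cx

    module _ (noDiamond : ¬ Diamond) where

      y≁x' : ¬ Adj G y x'
      y≁x' yx' = noDiamond (record { m₁m₂ = adj₂ Nx ; m₁t₁ = adj₁ Nx ; m₁t₂ = adj₃ Nx
                                   ; m₂t₁ = adj₁ Ny ; m₂t₂ = yx' ; t₁≢t₂ = a≢c Nx })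

      x'≢y' : x' ≢ y'
      x'≢y' refl = y≁x' (adj₃ Ny)

      s≢x' : s ≢ x'
      s≢x' refl = noDiamond (record { m₁m₂ = adj₂ Nu ; m₁t₁ = adj₃ Nu ; m₁t₂ = adj₁ Nu
                                    ; m₂t₁ = adj₂ Nx ; m₂t₂ = adj₃ Nx ; t₁≢t₂ = a≢c Nu ∘ ≡.sym })

      x≁s : ¬ Adj G x s
      x≁s = none Nx (Adj-irrefl (adj₁ Nu) ∘ ≡.sym) (a≢c Nu) s≢x'

-- The greedy process

module Greedy {n : ℕ} {G : Graph n} (cubic : Cubic G) (clawFree : ClawFree G) (connected : Connected G) where

  open Neighbours

  -- In a diamond-free graph the process may run one independent vertex short until C is full.
  IndependenceBound : (S C I : Subset n) → Set
  IndependenceBound S C I = ∣ S ∣ ≤ suc ∣ I ∣ ⊎ (¬ Diamond G × ∣ S ∣ ≤ 2 + ∣ I ∣ × ¬ Full C)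

  record IndependentPart (S C : Subset n) : Set where
    field
      I : Subset n
      I-saturated : ∀ {v} → v ∈ I → Saturated G C v
      I-independent : Independent G I
      I-bound : IndependenceBound S C I

  record State : Set where
    field
      S C : Subset n
      M : List (Fin n × Fin n)
      C-nonempty : Nonempty C
      S⊆C : S ⊆ C
      C-colored : ∀ {v} → v ∈ C → Colored G S v
      C-anchored : ∀ {v} → v ∈ C → ∃ λ s → Adj G v s × Saturated G C s
      M-matching : Matching G M
      M⊆C : All (λ e → proj₁ e ∈ C × proj₂ e ∈ C) M
      S≤M : ∣ S ∣ ≤ length M
      independentPart : IndependentPart S C

  Larger : State → Set
  Larger st = ∃ λ st' → State.C st ⊂ State.C st'

  module ForceStep (st : State) {f v} (f∈C : f ∈ State.C st) (v∉C : v ∉ State.C st) (fv : Adj G f v)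
    (others : ∀ w → Adj G f w → w ≢ v → w ∈ State.C st) where
    open State st
    open IndependentPart independentPart

    C' : Subset n
    C' = ⁅ v ⁆ ∪ C

    grow : C ⊆ C'
    grow = p⊆⁅x⁆∪p

    f-saturated : Saturated G C' f
    f-saturated = grow f∈C , λ {w} fw → case w ≟ v of λ where
      (yes refl) → x∈⁅x⁆∪p
      (no w≢v) → grow (others w fw w≢v)

    keep : IndependenceBound S C' I → IndependentPart S C'
    keep bound = record
      { I = I ; I-saturated = Saturated-mono G grow ∘ I-saturated ; I-independent = I-independent ; I-bound = bound }

    independentPart' : IndependentPart S C'
    independentPart' with I-bound | full? C'
    ... | inj₁ S≤1+I | _ = keep (inj₁ S≤1+I)
    ... | inj₂ (noDiamond , S≤2+I , _) | no ¬full = keep (inj₂ (noDiamond , S≤2+I , ¬full))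
    ... | inj₂ (_ , S≤2+I , _) | yes full = record
      { I = ⁅ v ⁆ ∪ I ; I-saturated = λ _ → Full⇒Saturated G full ; I-independent = proj₁ v+I
      ; I-bound = inj₁ (subst (λ k → ∣ S ∣ ≤ suc k) (≡.sym (proj₂ v+I)) S≤2+I) }
      where
      v+I : Independent G (⁅ v ⁆ ∪ I) × ∣ ⁅ v ⁆ ∪ I ∣ ≡ suc ∣ I ∣
      v+I = adjoin G I-saturated I-independent v∉C

    larger : Larger st
    larger = record
      { S = S ; C = C' ; M = M
      ; C-nonempty = v , x∈⁅x⁆∪p
      ; S⊆C = grow ∘ S⊆C
      ; C-colored = ⁅⁆∪-elim (force (C-colored f∈C) fv λ w fw w≢v → C-colored (others w fw w≢v)) C-colored
      ; C-anchored = ⁅⁆∪-elim (f , Adj-sym G fv , f-saturated) (map₂ (map₂ (Saturated-mono G grow)) ∘ C-anchored)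
      ; M-matching = M-matching
      ; M⊆C = All.map (map grow grow) M⊆C
      ; S≤M = S≤M
      ; independentPart = independentPart' } , p⊂⁅x⁆∪p v∉C

  module TriangleStep (st : State) (stuck : Stuck G (State.C st)) {u s x y x' y'}
    (Nu : Neighbours G u s x y) (Nx : Neighbours G x u y x') (Ny : Neighbours G y u x y')
    (u∈C : u ∈ State.C st) (s-saturated : Saturated G (State.C st) s)
    (x∉C : x ∉ State.C st) (y∉C : y ∉ State.C st) where
    open State st
    open IndependentPart independentPart
    open Triangle G Nu Nx Ny

    new : List (Fin n)
    new = x ∷ y ∷ x' ∷ y' ∷ []

    C' : Subset n
    C' = insertAll new C

    S' : Subset n
    S' = ⁅ x ⁆ ∪ S

    grow : C ⊆ C'
    grow = p⊆insertAll new

    new⊆C' : ∀ {v} → v ∈ₗ new → v ∈ C'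
    new⊆C' = ∈insertAll⁺

    x∈C' : x ∈ C'
    x∈C' = new⊆C' (here refl)
    y∈C' : y ∈ C'
    y∈C' = new⊆C' (there (here refl))
    x'∈C' : x' ∈ C'
    x'∈C' = new⊆C' (there (there (here refl)))
    y'∈C' : y' ∈ C'
    y'∈C' = new⊆C' (there (there (there (here refl))))

    u-saturated : Saturated G C' u
    u-saturated = saturated G Nu (grow u∈C) (grow (proj₁ s-saturated)) x∈C' y∈C'
    x-saturated : Saturated G C' x
    x-saturated = saturated G Nx x∈C' (grow u∈C) y∈C' x'∈C'
    y-saturated : Saturated G C' y
    y-saturated = saturated G Ny y∈C' (grow u∈C) x∈C' y'∈C'

    C'-colored : ∀ {v} → v ∈ C' → Colored G S' v
    C'-colored = insertAll-elim (cx ∷ colored (lift (C-colored u∈C)) (lift (C-colored (proj₁ s-saturated))) cx)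
                                (lift ∘ C-colored)
      where
      lift : ∀ {v} → Colored G S v → Colored G S' v
      lift = Colored-mono G p⊆⁅x⁆∪p
      cx : Colored G S' x
      cx = init x∈⁅x⁆∪p

    C'-anchored : ∀ {v} → v ∈ C' → ∃ λ t → Adj G v t × Saturated G C' t
    C'-anchored = insertAll-elim
      ((u , Adj-sym G (adj₂ Nu) , u-saturated) ∷ (u , Adj-sym G (adj₃ Nu) , u-saturated) ∷
       (x , Adj-sym G (adj₃ Nx) , x-saturated) ∷ (y , Adj-sym G (adj₃ Ny) , y-saturated) ∷ [])
      (map₂ (map₂ (Saturated-mono G grow)) ∘ C-anchored)

    M'-matching : Matching G ((x , y) ∷ M)
    M'-matching = adj₂ Nx ∷ proj₁ M-matching
                , All.map (λ (a∈C , b∈C) → outside x∉C a∈C , outside x∉C b∈C , outside y∉C a∈C , outside y∉C b∈C)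
                          M⊆C
                  ∷ proj₂ M-matching
      where
      outside : ∀ {a b} → a ∉ C → b ∈ C → a ≢ b
      outside a∉C b∈C refl = a∉C b∈C

    ∣S'∣ : ∣ S' ∣ ≡ suc ∣ S ∣
    ∣S'∣ = ∣⁅x⁆∪p∣ (x∉C ∘ S⊆C)

    x+I : Independent G (⁅ x ⁆ ∪ I) × ∣ ⁅ x ⁆ ∪ I ∣ ≡ suc ∣ I ∣
    x+I = adjoin G I-saturated I-independent x∉C

    add-x : IndependenceBound S' C' (⁅ x ⁆ ∪ I) → IndependentPart S' C'
    add-x bound = record
      { I = ⁅ x ⁆ ∪ I ; I-saturated = ⁅⁆∪-elim x-saturated (Saturated-mono G grow ∘ I-saturated)
      ; I-independent = proj₁ x+I ; I-bound = bound }

    add-pair : ∀ {a b} → a ∉ C → b ∉ C → a ≢ b → ¬ Adj G a b → ∣ S ∣ ≤ 2 + ∣ I ∣ → Full C' →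
      IndependentPart S' C'
    add-pair {a} {b} a∉C b∉C a≢b a≁b S≤2+I full = record
      { I = ⁅ b ⁆ ∪ ⁅ a ⁆ ∪ I ; I-saturated = λ _ → Full⇒Saturated G full ; I-independent = proj₁ a+b+I
      ; I-bound = inj₁ (subst₂ _≤_ (≡.sym ∣S'∣) (cong suc (≡.sym (proj₂ a+b+I))) (s≤s S≤2+I)) }
      where
      a+b+I : Independent G (⁅ b ⁆ ∪ ⁅ a ⁆ ∪ I) × ∣ ⁅ b ⁆ ∪ ⁅ a ⁆ ∪ I ∣ ≡ 2 + ∣ I ∣
      a+b+I = adjoin₂ G I-saturated I-independent a∉C b∉C a≢b a≁b

    grow-bound : ∀ {k} → ∣ S ∣ ≤ k + ∣ I ∣ → ∣ S' ∣ ≤ k + ∣ ⁅ x ⁆ ∪ I ∣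
    grow-bound {k} S≤k+I =
      subst₂ _≤_ (≡.sym ∣S'∣) (trans (≡.sym (+-suc k _)) (cong (k +_) (≡.sym (proj₂ x+I)))) (s≤s S≤k+I)

    independentPart' : IndependentPart S' C'
    independentPart' with I-bound | full? C'
    ... | inj₁ S≤1+I | _ = add-x (inj₁ (grow-bound S≤1+I))
    ... | inj₂ (noDiamond , S≤2+I , _) | no ¬full = add-x (inj₂ (noDiamond , grow-bound S≤2+I , ¬full))
    ... | inj₂ (noDiamond , S≤2+I , _) | yes full with y' ∈? C | x' ∈? C
    ...   | no y'∉C | _ = add-pair x∉C y'∉C (b≢c Ny) (Triangle.y≁x' G (swap₂₃ Nu) Ny Nx noDiamond) S≤2+I full
    ...   | yes _ | no x'∉C = add-pair y∉C x'∉C (b≢c Nx) (y≁x' noDiamond) S≤2+I full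
    ...   | yes y'∈C | yes x'∈C =
      ⊥-elim (stuck (x'∈C , x∉C , Adj-sym G (adj₃ Nx) , λ w x'w → x'-others (full w) x'w))
      where
      x'-others : ∀ {w} → w ∈ C' → Adj G x' w → w ≢ x → w ∈ C
      x'-others = insertAll-elim {P = λ w → Adj G x' w → w ≢ x → w ∈ C}
        ((λ _ x≢x → ⊥-elim (x≢x refl)) ∷ (λ x'y _ → ⊥-elim (y≁x' noDiamond (Adj-sym G x'y))) ∷
         (λ x'x' _ → ⊥-elim (Adj-irrefl G x'x' refl)) ∷ (λ _ _ → y'∈C) ∷ [])
        (λ w∈C _ _ → w∈C)

    larger : Larger st
    larger = record
      { S = S' ; C = C' ; M = (x , y) ∷ M
      ; C-nonempty = x , x∈C'
      ; S⊆C = ⁅⁆∪-elim x∈C' (grow ∘ S⊆C)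
      ; C-colored = C'-colored
      ; C-anchored = C'-anchored
      ; M-matching = M'-matching
      ; M⊆C = (x∈C' , y∈C') ∷ All.map (map grow grow) M⊆C
      ; S≤M = subst (_≤ suc (length M)) (≡.sym ∣S'∣) (s≤s S≤M)
      ; independentPart = independentPart' } , grow , x , x∈C' , x∉C

  module _ (st : State) where
    open State st

    stuck-step : Stuck G C → ¬ Full C → Larger st
    stuck-step stuck ¬full with ¬∀⟶∃¬ n _ (_∈? C) ¬full | C-nonempty
    ... | v , v∉C | c , c∈C with frontier G (connected c v) c∈C v∉C
    ... | u , x , u∈C , x∉C , ux with C-anchored u∈C
    ... | s , us , s-saturated with third G cubic us ux (λ { refl → x∉C (proj₁ s-saturated) })
    ... | y , Nu with y ∈? C
    ... | yes y∈C = ⊥-elim (stuck (forceable-third G (swap₂₃ Nu) u∈C (proj₁ s-saturated) y∈C x∉C))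
    ... | no y∉C with triangle-completion G cubic Nu
                        (clawFree⇒adj G clawFree Nu (Saturated⇒≁ G s-saturated x∉C) (Saturated⇒≁ G s-saturated y∉C))
    ... | x' , y' , Nx , Ny = TriangleStep.larger st stuck Nu Nx Ny u∈C s-saturated x∉C y∉C

    advance : Full C ⊎ Larger st
    advance with full? C | forceable? G C
    ... | yes full | _ = inj₁ full
    ... | no _ | yes (_ , _ , f∈C , v∉C , fv , others) = inj₂ (ForceStep.larger st f∈C v∉C fv others)
    ... | no ¬full | no ¬forceable = inj₂ (stuck-step (λ fv → ¬forceable (_ , _ , fv)) ¬full)

  module DiamondStart (¬K4 : ¬ IsK4 G) (D : Diamond G) where
    open Diamond D

    Nm₁ : Neighbours G m₁ t₁ t₂ m₂
    Nm₁ = neighbours G cubic m₁t₁ m₁t₂ m₁m₂ t₁≢t₂ (Adj-irrefl G m₂t₁ ∘ ≡.sym) (Adj-irrefl G m₂t₂ ∘ ≡.sym)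

    Nm₂ : Neighbours G m₂ t₁ t₂ m₁
    Nm₂ = neighbours G cubic m₂t₁ m₂t₂ (Adj-sym G m₁m₂) t₁≢t₂
            (Adj-irrefl G m₁t₁ ∘ ≡.sym) (Adj-irrefl G m₁t₂ ∘ ≡.sym)

    t₁≁t₂ : ¬ Adj G t₁ t₂
    t₁≁t₂ t₁t₂ = ¬K4 (connected-cubic⇒K4 G connected cubic m₁m₂ m₁t₁ m₁t₂ m₂t₁ m₂t₂ t₁t₂)

    tail-of : ∀ {t} → Adj G m₁ t → Adj G m₂ t → ∃ (Neighbours G t m₁ m₂)
    tail-of m₁t m₂t = third G cubic (Adj-sym G m₁t) (Adj-sym G m₂t) (Adj-irrefl G m₁m₂)

    e₁ : Fin n
    e₁ = proj₁ (tail-of m₁t₁ m₂t₁)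
    Nt₁ : Neighbours G t₁ m₁ m₂ e₁
    Nt₁ = proj₂ (tail-of m₁t₁ m₂t₁)
    e₂ : Fin n
    e₂ = proj₁ (tail-of m₁t₂ m₂t₂)
    Nt₂ : Neighbours G t₂ m₁ m₂ e₂
    Nt₂ = proj₂ (tail-of m₁t₂ m₂t₂)

    -- A common tail e of the tips would be the centre of a claw with t₁, t₂ and its third neighbour.
    no-common-tail : ∀ {e} → Neighbours G t₁ m₁ m₂ e → ¬ Neighbours G t₂ m₁ m₂ e
    no-common-tail {e} N₁ N₂ with third G cubic (Adj-sym G (adj₃ N₁)) (Adj-sym G (adj₃ N₂)) t₁≢t₂
    ... | f , Ne = no-claw G clawFree Ne t₁≁t₂ (none N₁ f≢m₁ f≢m₂ f≢e) (none N₂ f≢m₁ f≢m₂ f≢e)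
      where
      f≢e : f ≢ e
      f≢e = Adj-irrefl G (adj₃ Ne) ∘ ≡.sym
      m≁e : ∀ {m t t' m'} → Neighbours G m t t' m' → Neighbours G t m m' e → ¬ Adj G t t' → ¬ Adj G m e
      m≁e Nm Nt t≁t' = none Nm (Adj-irrefl G (adj₃ Nt) ∘ ≡.sym) (≁-distinct G (adj₃ Nt) t≁t') (b≢c Nt ∘ ≡.sym)
      f≢m₁ : f ≢ m₁
      f≢m₁ refl = m≁e Nm₁ N₁ t₁≁t₂ (Adj-sym G (adj₃ Ne))
      f≢m₂ : f ≢ m₂
      f≢m₂ refl = m≁e Nm₂ (swap₁₂ N₁) t₁≁t₂ (Adj-sym G (adj₃ Ne))

    e₁≢e₂ : e₁ ≢ e₂
    e₁≢e₂ e₁≡e₂ = no-common-tail Nt₁ (subst (Neighbours G t₂ m₁ m₂) (≡.sym e₁≡e₂) Nt₂)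

    LS LC : List (Fin n)
    LS = m₁ ∷ t₁ ∷ t₂ ∷ []
    LC = m₁ ∷ t₁ ∷ t₂ ∷ m₂ ∷ e₁ ∷ e₂ ∷ []

    S C I : Subset n
    S = fromList LS
    C = fromList LC
    I = fromList (t₁ ∷ t₂ ∷ [])

    ∣S∣≡3 : ∣ S ∣ ≡ 3
    ∣S∣≡3 = ∣fromList∣ ((Adj-irrefl G m₁t₁ ∷ Adj-irrefl G m₁t₂ ∷ []) ∷ (t₁≢t₂ ∷ []) ∷ [] ∷ [])

    ∣I∣≡2 : ∣ I ∣ ≡ 2
    ∣I∣≡2 = ∣fromList∣ ((t₁≢t₂ ∷ []) ∷ [] ∷ [])

    LC⊆C : ∀ {v} → v ∈ₗ LC → v ∈ C
    LC⊆C = ∈insertAll⁺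

    m₁∈ : m₁ ∈ C
    m₁∈ = LC⊆C (here refl)
    t₁∈ : t₁ ∈ C
    t₁∈ = LC⊆C (there (here refl))
    t₂∈ : t₂ ∈ C
    t₂∈ = LC⊆C (there (there (here refl)))
    m₂∈ : m₂ ∈ C
    m₂∈ = LC⊆C (there (there (there (here refl))))
    e₁∈ : e₁ ∈ C
    e₁∈ = LC⊆C (there (there (there (there (here refl)))))
    e₂∈ : e₂ ∈ C
    e₂∈ = LC⊆C (there (there (there (there (there (here refl))))))

    m₁-saturated : Saturated G C m₁
    m₁-saturated = saturated G Nm₁ m₁∈ t₁∈ t₂∈ m₂∈
    t₁-saturated : Saturated G C t₁
    t₁-saturated = saturated G Nt₁ t₁∈ m₁∈ m₂∈ e₁∈
    t₂-saturated : Saturated G C t₂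
    t₂-saturated = saturated G Nt₂ t₂∈ m₁∈ m₂∈ e₂∈

    C-colored : ∀ {v} → v ∈ C → Colored G S v
    C-colored = fromList-elim
      (cm₁ ∷ ct₁ ∷ ct₂ ∷ cm₂ ∷ force-third G Nt₁ ct₁ cm₁ cm₂ ∷ force-third G Nt₂ ct₂ cm₁ cm₂ ∷ [])
      where
      seed : ∀ {v} → v ∈ₗ LS → Colored G S v
      seed = init ∘ ∈insertAll⁺
      cm₁ : Colored G S m₁
      cm₁ = seed (here refl)
      ct₁ : Colored G S t₁
      ct₁ = seed (there (here refl))
      ct₂ : Colored G S t₂
      ct₂ = seed (there (there (here refl)))
      cm₂ : Colored G S m₂
      cm₂ = force-third G Nm₁ cm₁ ct₁ ct₂

    M-matching : Matching G ((m₁ , m₂) ∷ (t₁ , e₁) ∷ (t₂ , e₂) ∷ [])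
    M-matching =
        (m₁m₂ ∷ adj₃ Nt₁ ∷ adj₃ Nt₂ ∷ [])
      , ((Adj-irrefl G m₁t₁ , a≢c Nt₁ , Adj-irrefl G m₂t₁ , b≢c Nt₁) ∷
         (Adj-irrefl G m₁t₂ , a≢c Nt₂ , Adj-irrefl G m₂t₂ , b≢c Nt₂) ∷ []) ∷
        ((t₁≢t₂ , ≁-distinct G (adj₃ Nt₂) (t₁≁t₂ ∘ Adj-sym G) ∘ ≡.sym , ≁-distinct G (adj₃ Nt₁) t₁≁t₂ , e₁≢e₂)
          ∷ []) ∷
        [] ∷ []

    state : State
    state = record
      { S = S ; C = C ; M = (m₁ , m₂) ∷ (t₁ , e₁) ∷ (t₂ , e₂) ∷ []
      ; C-nonempty = m₁ , m₁∈
      ; S⊆C = fromList-elim (m₁∈ ∷ t₁∈ ∷ t₂∈ ∷ [])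
      ; C-colored = C-colored
      ; C-anchored = fromList-elim
          ((t₁ , m₁t₁ , t₁-saturated) ∷ (m₁ , Adj-sym G m₁t₁ , m₁-saturated) ∷
           (m₁ , Adj-sym G m₁t₂ , m₁-saturated) ∷ (t₁ , m₂t₁ , t₁-saturated) ∷
           (t₁ , Adj-sym G (adj₃ Nt₁) , t₁-saturated) ∷ (t₂ , Adj-sym G (adj₃ Nt₂) , t₂-saturated) ∷ [])
      ; M-matching = M-matching
      ; M⊆C = (m₁∈ , m₂∈) ∷ (t₁∈ , e₁∈) ∷ (t₂∈ , e₂∈) ∷ []
      ; S≤M = ≤-reflexive ∣S∣≡3
      ; independentPart = record
          { I = I
          ; I-saturated = fromList-elim (t₁-saturated ∷ t₂-saturated ∷ [])
          ; I-independent = independent-fromList G ((t₁≁t₂ ∷ []) ∷ [] ∷ [])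
          ; I-bound = inj₁ (≤-reflexive (trans ∣S∣≡3 (cong suc (≡.sym ∣I∣≡2)))) } }

  module TriangleStart (noDiamond : ¬ Diamond G) {u s x y x' y'}
    (Nu : Neighbours G u s x y) (Nx : Neighbours G x u y x') (Ny : Neighbours G y u x y') where
    open Triangle G Nu Nx Ny

    LS LC : List (Fin n)
    LS = u ∷ s ∷ x ∷ []
    LC = u ∷ s ∷ x ∷ y ∷ x' ∷ y' ∷ []

    S C : Subset n
    S = fromList LS
    C = fromList LC

    ∣S∣≡3 : ∣ S ∣ ≡ 3
    ∣S∣≡3 = ∣fromList∣ ((Adj-irrefl G (adj₁ Nu) ∷ Adj-irrefl G (adj₂ Nu) ∷ []) ∷ (a≢b Nu ∷ []) ∷ [] ∷ [])

    LC⊆C : ∀ {v} → v ∈ₗ LC → v ∈ C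
    LC⊆C = ∈insertAll⁺

    u∈ : u ∈ C
    u∈ = LC⊆C (here refl)
    s∈ : s ∈ C
    s∈ = LC⊆C (there (here refl))
    x∈ : x ∈ C
    x∈ = LC⊆C (there (there (here refl)))
    y∈ : y ∈ C
    y∈ = LC⊆C (there (there (there (here refl))))
    x'∈ : x' ∈ C
    x'∈ = LC⊆C (there (there (there (there (here refl)))))
    y'∈ : y' ∈ C
    y'∈ = LC⊆C (there (there (there (there (there (here refl))))))

    u-saturated : Saturated G C u
    u-saturated = saturated G Nu u∈ s∈ x∈ y∈
    x-saturated : Saturated G C x
    x-saturated = saturated G Nx x∈ u∈ y∈ x'∈
    y-saturated : Saturated G C y
    y-saturated = saturated G Ny y∈ u∈ x∈ y'∈

    C-colored : ∀ {v} → v ∈ C → Colored G S v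
    C-colored = fromList-elim (cu ∷ cs ∷ cx ∷ colored cu cs cx)
      where
      seed : ∀ {v} → v ∈ₗ LS → Colored G S v
      seed = init ∘ ∈insertAll⁺
      cu : Colored G S u
      cu = seed (here refl)
      cs : Colored G S s
      cs = seed (there (here refl))
      cx : Colored G S x
      cx = seed (there (there (here refl)))

    M-matching : Matching G ((u , s) ∷ (x , x') ∷ (y , y') ∷ [])
    M-matching =
        (adj₁ Nu ∷ adj₃ Nx ∷ adj₃ Ny ∷ [])
      , ((Adj-irrefl G (adj₂ Nu) , a≢c Nx , a≢b Nu , s≢x' noDiamond) ∷
         (Adj-irrefl G (adj₃ Nu) , a≢c Ny , a≢c Nu , Triangle.s≢x' G (swap₂₃ Nu) Ny Nx noDiamond) ∷ []) ∷
        ((b≢c Nu , b≢c Ny , b≢c Nx ∘ ≡.sym , x'≢y' noDiamond) ∷ []) ∷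
        [] ∷ []

    independentPart : IndependentPart S C
    independentPart with full? C
    ... | yes full = record
      { I = fromList (x ∷ s ∷ [])
      ; I-saturated = λ _ → Full⇒Saturated G full
      ; I-independent = independent-fromList G ((x≁s noDiamond ∷ []) ∷ [] ∷ [])
      ; I-bound = inj₁ (≤-reflexive (trans ∣S∣≡3 (cong suc (≡.sym ∣I∣≡2)))) }
      where
      ∣I∣≡2 : ∣ fromList (x ∷ s ∷ []) ∣ ≡ 2
      ∣I∣≡2 = ∣fromList∣ ((a≢b Nu ∘ ≡.sym ∷ []) ∷ [] ∷ [])
    ... | no ¬full = record
      { I = fromList (x ∷ [])
      ; I-saturated = fromList-elim (x-saturated ∷ [])
      ; I-independent = independent-fromList G ([] ∷ [])
      ; I-bound = inj₂ (noDiamond , ≤-reflexive (trans ∣S∣≡3 (cong (2 +_) (≡.sym ∣I∣≡1))) , ¬full) }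
      where
      ∣I∣≡1 : ∣ fromList (x ∷ []) ∣ ≡ 1
      ∣I∣≡1 = ∣fromList∣ {xs = x ∷ []} ([] ∷ [])

    state : State
    state = record
      { S = S ; C = C ; M = (u , s) ∷ (x , x') ∷ (y , y') ∷ []
      ; C-nonempty = u , u∈
      ; S⊆C = fromList-elim (u∈ ∷ s∈ ∷ x∈ ∷ [])
      ; C-colored = C-colored
      ; C-anchored = fromList-elim
          ((x , adj₂ Nu , x-saturated) ∷ (u , Adj-sym G (adj₁ Nu) , u-saturated) ∷
           (u , Adj-sym G (adj₂ Nu) , u-saturated) ∷ (u , Adj-sym G (adj₃ Nu) , u-saturated) ∷
           (x , Adj-sym G (adj₃ Nx) , x-saturated) ∷ (y , Adj-sym G (adj₃ Ny) , y-saturated) ∷ [])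
      ; M-matching = M-matching
      ; M⊆C = (u∈ , s∈) ∷ (x∈ , x'∈) ∷ (y∈ , y'∈) ∷ []
      ; S≤M = ≤-reflexive ∣S∣≡3
      ; independentPart = independentPart }

  initial : ¬ IsK4 G → Fin n → State
  initial ¬K4 u with diamond? G
  ... | yes D = DiamondStart.state ¬K4 D
  ... | no noDiamond with triangle-at G cubic clawFree u
  ... | s , x , y , Nu , xy with triangle-completion G cubic Nu xy
  ... | x' , y' , Nx , Ny = TriangleStart.state noDiamond Nu Nx Ny

  certificate : ¬ IsK4 G → Fin n → ZeroForcingCertificate G
  certificate ¬K4 u with iterate State.C advance (initial ¬K4 u)
  ... | st , full = record
    { S = S ; I = I ; M = M
    ; S-forcing = λ v → C-colored (full v)
    ; I-independent = I-independent
    ; M-matching = M-matching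
    ; S≤1+I = no-slack I-bound
    ; S≤M = S≤M }
    where
    open State st
    open IndependentPart independentPart
    no-slack : IndependenceBound S C I → ∣ S ∣ ≤ suc ∣ I ∣
    no-slack (inj₁ S≤1+I) = S≤1+I
    no-slack (inj₂ (_ , _ , ¬full)) = ⊥-elim (¬full full)

claw-free-cubic-certificate : ∀ {n} (G : Graph n) → Connected G → ClawFree G → Cubic G → ¬ IsK4 G →
  ZeroForcingCertificate G
claw-free-cubic-certificate {zero} G _ _ _ _ = record
  { S = ⊥ ; I = ⊥ ; M = [] ; S-forcing = λ () ; I-independent = λ () ; M-matching = [] , []
  ; S≤1+I = z≤n ; S≤M = z≤n }
claw-free-cubic-certificate {suc _} G connected clawFree cubic ¬K4 =
  Greedy.certificate cubic clawFree connected ¬K4 zero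

theorem3p1 : ∀ {n : ℕ} (G : Graph n) → Connected G → ClawFree G → Cubic G →
    ¬ IsK4 G → ∀ z a m → IsZeroForcingNumber G z →
    IsIndependenceNumber G a → IsMatchingNumber G m →
    (z ≤ a + 1) × (z ≤ m)
theorem3p1 G connected clawFree cubic ¬K4 z a m zero-forcing-number independence-number matching-number =
  certificate⇒bounds G (claw-free-cubic-certificate G connected clawFree cubic ¬K4)
    zero-forcing-number independence-number matching-number
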